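{- Let $a(n,m)$ denote the number of Arndt compositions of $n$ with exactly $m$ parts. For all integers $n,m\ge 0$, $$a(n,m)=\sum_{\ell=0}^{n-m-\lfloor m/2\rfloor}\binom{m + \ell - 1}{\ell}\binom{n - m - \ell - 1}{n - m - \lfloor m/2\rfloor - \ell}(-1)^{n - m -\lfloor m/2\rfloor - \ell}$$ (an empty sum being $0$). Moreover, for all $n\ge 3$ and $m\ge 2$, $$a(n,m)=a(n-1,m)+a(n-2,m) - a(n-3,m) + a(n-3,m-2).$$
   Context: A composition of $n\ge 0$ is a finite sequence $(\sigma_1,\dots,\sigma_\ell)$ of positive integers summing to $n$ (the empty composition is the composition of $0$ with $0$ parts). An Arndt composition is one with $\sigma_{2i-1}>\sigma_{2i}$ for every positive integer $i$ with $2i\le\ell$. Binomial coefficients are $\binom{a}{b}=a(a-1)\cdots(a-b+1)/b!$ for integer $a$ and nonnegative integer $b$ (so e.g. $\binom{ -1}{0}=1$ and $\binom{a}{b}=0$ when $0\le a<b$). -}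

module Defs where

open import Data.Nat as ℕ using (ℕ; zero; suc; _≤_; _<_; _∸_; _≤?_)
open import Data.Nat.Properties using (_!≢0)
open import Data.Nat.Base using (_!; _/_)
open import Data.Integer as ℤ using (ℤ; +_; -_; _-_)
open import Data.Integer.DivMod using (_/ℕ_)
open import Data.List using (List; []; _∷_; length; foldr; map; upTo)
open import Data.Nat.ListAction using (sum)
open import Data.List.Relation.Unary.All using (All)
open import Data.Product using (Σ; _×_)
open import Data.Unit using (⊤)
open import Relation.Binary.PropositionalEquality using (_≡_)
open import Relation.Nullary using (yes; no)

IsArndt : List ℕ → Set
IsArndt []            = ⊤
IsArndt (x ∷ [])      = ⊤
IsArndt (x ∷ y ∷ r)   = (y < x) × IsArndt r

ArndtComp : ℕ → ℕ → Set
ArndtComp n m = Σ (List ℕ) λ c →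
  All (λ x → 1 ≤ x) c × sum c ≡ n × length c ≡ m × IsArndt c

falling : ℤ → ℕ → ℤ
falling a zero    = + 1
falling a (suc b) = a ℤ.* falling (a - + 1) b

binomℤ : ℤ → ℕ → ℤ
binomℤ a b = _/ℕ_ (falling a b) (b !) {{b !≢0}}

sumℤ : List ℤ → ℤ
sumℤ = foldr ℤ._+_ (+ 0)

signℤ : ℕ → ℤ
signℤ zero    = + 1
signℤ (suc k) = - signℤ k

arndtFormula : ℕ → ℕ → ℤ
arndtFormula n m with (m ℕ.+ m / 2) ≤? n
... | no _  = + 0
... | yes _ = sumℤ (map term (upTo (suc N)))
  where
    N : ℕ
    N = n ∸ (m ℕ.+ m / 2)
    term : ℕ → ℤ
    term ℓ = binomℤ ((+ m ℤ.+ + ℓ) - + 1) ℓ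
             ℤ.* binomℤ (((+ n - + m) - + ℓ) - + 1) (N ∸ ℓ)
             ℤ.* signℤ (N ∸ ℓ)

{-# OPTIONS --safe #-}
-- Take off the first pair (x, y) of an Arndt composition: if y ≥ 2 lower x and y by one,
-- and if y = 1 either x = 2 and the pair is dropped, or x is lowered by one. With b(n, m) the
-- number of Arndt compositions of n with m + 2 parts whose second part is 1, this gives
-- a(n+2, m+2) = a(n, m+2) + b(n+2, m) and b(n+3, m) = a(n, m) + b(n+2, m), from which the
-- recurrence is immediate. Shifted by the minimal sum m + ⌊m/2⌋, the two recursions say that
-- the generating function of a(·, m+2) is that of a(·, m) divided by (1 - q)(1 - q²). The
-- closed formula is the coefficient of q^N in (1 - q)^(-m) (1 + q)^(-⌊m/2⌋), a convolution of
-- multiset coefficients and signed ones, and dividing it by (1 - q)²(1 + q) raises m by 2.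
module Submission where

open import Defs
open import Agda.Builtin.Nat using (div-helper)
open import Data.Nat as ℕ
  using (ℕ; zero; suc; _≤_; _<_; _∸_; z≤n; s≤s; _≤?_; _/_; _!; ⌊_/2⌋)
import Data.Nat.Properties as ℕ
open import Data.Nat.DivMod using (m*n/n≡m)
open import Data.Nat.ListAction using (sum)
open import Data.Integer using (ℤ; +_; -_; _+_; _-_; _*_)
import Data.Integer.Properties as ℤ
open import Data.List using (List; []; _∷_; length; map; upTo; applyUpTo)
open import Data.List.Properties using (map-upTo)
open import Data.List.Relation.Unary.All as All using (All; []; _∷_)
open import Data.Fin using (Fin; zero)
open import Data.Fin.Properties using (+↔⊎)
open import Data.Fin.Permutation using (↔⇒≡)
open import Data.Product using (Σ; _×_; _,_)
open import Data.Sum using (_⊎_; inj₁; inj₂)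
open import Data.Sum.Function.Propositional using (_⊎-↔_)
open import Data.Unit using (tt)
open import Data.Empty using (⊥-elim)
open import Function.Base using (_∘_)
open import Function.Bundles using (_↔_; mk↔ₛ′)
open import Function.Properties.Inverse using (↔-trans; ↔-sym)
open import Relation.Nullary using (¬_; yes; no)
open import Relation.Nullary.Irrelevant using (Irrelevant)
open import Relation.Binary.PropositionalEquality
  using (_≡_; refl; sym; trans; cong; cong₂; subst; _≗_; module ≡-Reasoning)
import Data.Nat.Tactic.RingSolver as ℕ-Ring
import Data.Integer.Tactic.RingSolver as ℤ-Ring

IsArndtCompOf : ℕ → ℕ → List ℕ → Set
IsArndtCompOf n m c = All (1 ≤_) c × sum c ≡ n × length c ≡ m × IsArndt c

ArndtCompSecondOne : ℕ → ℕ → Set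
ArndtCompSecondOne n m =
  Σ ℕ λ x → Σ (List ℕ) λ r → IsArndtCompOf n (2 ℕ.+ m) (x ∷ 1 ∷ r)

forgetSecondOne : ∀ {n m} → ArndtCompSecondOne n m → ArndtComp n (2 ℕ.+ m)
forgetSecondOne (x , r , p) = (x ∷ 1 ∷ r) , p

mutual
  arndtCount : ℕ → ℕ → ℕ
  arndtCount zero          zero          = 1
  arndtCount (suc n)       zero          = 0
  arndtCount zero          (suc zero)    = 0
  arndtCount (suc n)       (suc zero)    = 1
  arndtCount zero          (suc (suc m)) = 0
  arndtCount (suc zero)    (suc (suc m)) = 0
  arndtCount (suc (suc n)) (suc (suc m)) =
    arndtCount n (suc (suc m)) ℕ.+ secondOneCount (suc (suc n)) m

  secondOneCount : ℕ → ℕ → ℕ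
  secondOneCount zero                m = 0
  secondOneCount (suc zero)          m = 0
  secondOneCount (suc (suc zero))    m = 0
  secondOneCount (suc (suc (suc n))) m =
    arndtCount n m ℕ.+ secondOneCount (suc (suc n)) m

isArndt-irrelevant : ∀ c → Irrelevant (IsArndt c)
isArndt-irrelevant []          tt       tt         = refl
isArndt-irrelevant (x ∷ [])    tt       tt         = refl
isArndt-irrelevant (x ∷ y ∷ r) (p , ps) (p′ , ps′) =
  cong₂ _,_ (ℕ.≤-irrelevant p p′) (isArndt-irrelevant r ps ps′)

isArndtCompOf-irrelevant : ∀ {n m} c → Irrelevant (IsArndtCompOf n m c)
isArndtCompOf-irrelevant c (a , s , l , i) (a′ , s′ , l′ , i′) =
  cong₂ _,_ (All.irrelevant ℕ.≤-irrelevant a a′)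
    (cong₂ _,_ (ℕ.≡-irrelevant s s′)
      (cong₂ _,_ (ℕ.≡-irrelevant l l′) (isArndt-irrelevant c i i′)))

arndtComp-≡ : ∀ {n m c d} {p : IsArndtCompOf n m c} {q : IsArndtCompOf n m d} →
              c ≡ d → _≡_ {A = ArndtComp n m} (c , p) (d , q)
arndtComp-≡ {c = c} refl = cong (c ,_) (isArndtCompOf-irrelevant c _ _)

arndtCompSecondOne-≡ : ∀ {n m x y r s}
                       {p : IsArndtCompOf n (2 ℕ.+ m) (x ∷ 1 ∷ r)}
                       {q : IsArndtCompOf n (2 ℕ.+ m) (y ∷ 1 ∷ s)} →
                       x ≡ y → r ≡ s →
                       _≡_ {A = ArndtCompSecondOne n m} (x , r , p) (y , s , q)
arndtCompSecondOne-≡ {x = x} {r = r} refl refl =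
  cong (λ p → x , r , p) (isArndtCompOf-irrelevant _ _ _)

arndtMinSum : ℕ → ℕ
arndtMinSum m = m ℕ.+ ⌊ m /2⌋

arndtMinSum-2+ : ∀ m → arndtMinSum (2 ℕ.+ m) ≡ 3 ℕ.+ arndtMinSum m
arndtMinSum-2+ m = cong (2 ℕ.+_) (ℕ.+-suc m ⌊ m /2⌋)

arndtMinSum≤sum : ∀ {c} → All (1 ≤_) c → IsArndt c → arndtMinSum (length c) ≤ sum c
arndtMinSum≤sum [] tt = z≤n
arndtMinSum≤sum {x ∷ []} (1≤x ∷ []) tt = ℕ.≤-trans 1≤x (ℕ.m≤m+n x 0)
arndtMinSum≤sum {x ∷ y ∷ r} (_ ∷ 1≤y ∷ a) (y<x , i) = begin
  arndtMinSum (2 ℕ.+ length r)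
    ≡⟨ arndtMinSum-2+ (length r) ⟩
  2 ℕ.+ (1 ℕ.+ arndtMinSum (length r))
    ≤⟨ ℕ.+-mono-≤ 2≤x (ℕ.+-mono-≤ 1≤y (arndtMinSum≤sum a i)) ⟩
  x ℕ.+ (y ℕ.+ sum r) ∎
  where
  open ℕ.≤-Reasoning
  2≤x : 2 ≤ x
  2≤x = ℕ.≤-trans (s≤s 1≤y) y<x

¬arndtComp : ∀ {n m} → n < arndtMinSum m → ¬ ArndtComp n m
¬arndtComp n<min (c , a , refl , refl , i) = ℕ.<⇒≱ n<min (arndtMinSum≤sum a i)

3≤arndtMinSum : ∀ m → 3 ≤ arndtMinSum (2 ℕ.+ m)
3≤arndtMinSum m = ℕ.≤-trans (ℕ.m≤m+n 3 _) (ℕ.≤-reflexive (sym (arndtMinSum-2+ m)))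

¬arndtComp-<3 : ∀ {n m} → n < 3 → ¬ ArndtComp n (2 ℕ.+ m)
¬arndtComp-<3 {m = m} n<3 = ¬arndtComp (ℕ.<-≤-trans n<3 (3≤arndtMinSum m))

module _ {n m : ℕ} where

  lowerFirstPair : ArndtComp (2 ℕ.+ n) (2 ℕ.+ m) →
                   ArndtComp n (2 ℕ.+ m) ⊎ ArndtCompSecondOne (2 ℕ.+ n) m
  lowerFirstPair ((x ∷ zero ∷ r) , (_ ∷ () ∷ _) , _)
  lowerFirstPair ((x ∷ suc zero ∷ r) , p) = inj₂ (x , r , p)
  lowerFirstPair ((zero ∷ suc (suc y) ∷ r) , _ , _ , _ , (() , _))
  lowerFirstPair ((suc x ∷ suc (suc y) ∷ r) , (_ ∷ _ ∷ a) , e , l , (s≤s y<x , i)) =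
    inj₁ ((x ∷ suc y ∷ r) , (ℕ.≤-trans (s≤s z≤n) y<x ∷ s≤s z≤n ∷ a) , e′ , l , (y<x , i))
    where
    e′ : x ℕ.+ (suc y ℕ.+ sum r) ≡ n
    e′ = ℕ.suc-injective (trans (sym (ℕ.+-suc x _)) (ℕ.suc-injective e))

  raiseFirstPair : ArndtComp n (2 ℕ.+ m) ⊎ ArndtCompSecondOne (2 ℕ.+ n) m →
                   ArndtComp (2 ℕ.+ n) (2 ℕ.+ m)
  raiseFirstPair (inj₁ ((x ∷ y ∷ r) , (_ ∷ _ ∷ a) , e , l , (y<x , i))) =
    (suc x ∷ suc y ∷ r) , (s≤s z≤n ∷ s≤s z≤n ∷ a) , e′ , l , (s≤s y<x , i)
    where
    e′ : suc x ℕ.+ (suc y ℕ.+ sum r) ≡ 2 ℕ.+ n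
    e′ = cong suc (trans (ℕ.+-suc x _) (cong suc e))
  raiseFirstPair (inj₂ c) = forgetSecondOne c

  lowerFirstPair-↔ : ArndtComp (2 ℕ.+ n) (2 ℕ.+ m) ↔
                     (ArndtComp n (2 ℕ.+ m) ⊎ ArndtCompSecondOne (2 ℕ.+ n) m)
  lowerFirstPair-↔ = mk↔ₛ′ lowerFirstPair raiseFirstPair lower∘raise raise∘lower
    where
    raise∘lower : ∀ c → raiseFirstPair (lowerFirstPair c) ≡ c
    raise∘lower ((x ∷ zero ∷ r) , (_ ∷ () ∷ _) , _)
    raise∘lower ((x ∷ suc zero ∷ r) , p) = refl
    raise∘lower ((zero ∷ suc (suc y) ∷ r) , _ , _ , _ , (() , _))
    raise∘lower ((suc x ∷ suc (suc y) ∷ r) , (_ ∷ _ ∷ _) , _ , _ , (s≤s _ , _)) =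
      arndtComp-≡ refl

    lower∘raise : ∀ c → lowerFirstPair (raiseFirstPair c) ≡ c
    lower∘raise (inj₁ ((x ∷ zero ∷ r) , (_ ∷ () ∷ _) , _))
    lower∘raise (inj₁ ((x ∷ suc y ∷ r) , (_ ∷ _ ∷ _) , _)) = cong inj₁ (arndtComp-≡ refl)
    lower∘raise (inj₂ (x , r , p)) = refl

  lowerFirstPart : ArndtCompSecondOne (3 ℕ.+ n) m →
                   ArndtComp n m ⊎ ArndtCompSecondOne (2 ℕ.+ n) m
  lowerFirstPart (zero , r , _ , _ , _ , (() , _))
  lowerFirstPart (suc zero , r , _ , _ , _ , (s≤s () , _))
  lowerFirstPart (suc (suc zero) , r , (_ ∷ _ ∷ a) , e , l , (_ , i)) =
    inj₁ (r , a , cong (_∸ 3) e , cong (_∸ 2) l , i)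
  lowerFirstPart (suc (suc (suc x)) , r , (_ ∷ a) , e , l , (_ , i)) =
    inj₂ (suc (suc x) , r , (s≤s z≤n ∷ a) , cong ℕ.pred e , l , (s≤s (s≤s z≤n) , i))

  raiseFirstPart : ArndtComp n m ⊎ ArndtCompSecondOne (2 ℕ.+ n) m →
                   ArndtCompSecondOne (3 ℕ.+ n) m
  raiseFirstPart (inj₁ (r , a , e , l , i)) =
    2 , r , (s≤s z≤n ∷ s≤s z≤n ∷ a) , cong (3 ℕ.+_) e , cong (2 ℕ.+_) l , (s≤s (s≤s z≤n) , i)
  raiseFirstPart (inj₂ (x , r , (_ ∷ a) , e , l , (1<x , i))) =
    suc x , r , (s≤s z≤n ∷ a) , cong suc e , l , (ℕ.m<n⇒m<1+n 1<x , i)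

  lowerFirstPart-↔ : ArndtCompSecondOne (3 ℕ.+ n) m ↔
                     (ArndtComp n m ⊎ ArndtCompSecondOne (2 ℕ.+ n) m)
  lowerFirstPart-↔ = mk↔ₛ′ lowerFirstPart raiseFirstPart lower∘raise raise∘lower
    where
    raise∘lower : ∀ c → raiseFirstPart (lowerFirstPart c) ≡ c
    raise∘lower (zero , r , _ , _ , _ , (() , _))
    raise∘lower (suc zero , r , _ , _ , _ , (s≤s () , _))
    raise∘lower (suc (suc zero) , r , (_ ∷ _ ∷ _) , _) = arndtCompSecondOne-≡ refl refl
    raise∘lower (suc (suc (suc x)) , r , (_ ∷ _) , _) = arndtCompSecondOne-≡ refl refl

    lower∘raise : ∀ c → lowerFirstPart (raiseFirstPart c) ≡ c
    lower∘raise (inj₁ (r , _)) = cong inj₁ (arndtComp-≡ refl)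
    lower∘raise (inj₂ (zero , r , _ , _ , _ , (() , _)))
    lower∘raise (inj₂ (suc zero , r , _ , _ , _ , (s≤s () , _)))
    lower∘raise (inj₂ (suc (suc x) , r , (_ ∷ _) , _)) =
      cong inj₂ (arndtCompSecondOne-≡ refl refl)

Fin0↔ : ∀ {A : Set} → ¬ A → Fin 0 ↔ A
Fin0↔ ¬a = mk↔ₛ′ (λ ()) (λ a → ⊥-elim (¬a a)) (λ a → ⊥-elim (¬a a)) (λ ())

Fin1↔ : ∀ {A : Set} (a : A) → (∀ b → b ≡ a) → Fin 1 ↔ A
Fin1↔ a unique = mk↔ₛ′ (λ _ → a) (λ _ → zero) (λ b → sym (unique b)) (λ { zero → refl })

Fin+↔⊎ : ∀ {a b} {A B : Set} → Fin a ↔ A → Fin b ↔ B → Fin (a ℕ.+ b) ↔ (A ⊎ B)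
Fin+↔⊎ f g = ↔-trans +↔⊎ (f ⊎-↔ g)

mutual
  arndtCount-↔ : ∀ n m → Fin (arndtCount n m) ↔ ArndtComp n m
  arndtCount-↔ zero          zero          =
    Fin1↔ ([] , [] , refl , refl , tt) λ { ([] , _) → arndtComp-≡ refl }
  arndtCount-↔ (suc n)       zero          = Fin0↔ λ { ([] , _ , () , _) }
  arndtCount-↔ zero          (suc zero)    = Fin0↔ (¬arndtComp (s≤s z≤n))
  arndtCount-↔ (suc n)       (suc zero)    =
    Fin1↔ ((suc n ∷ []) , (s≤s z≤n ∷ []) , ℕ.+-identityʳ (suc n) , refl , tt)
      λ { ((x ∷ []) , _ , e , _) →
          arndtComp-≡ (cong (_∷ []) (trans (sym (ℕ.+-identityʳ x)) e)) }
  arndtCount-↔ zero          (suc (suc m)) = Fin0↔ (¬arndtComp-<3 (s≤s z≤n))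
  arndtCount-↔ (suc zero)    (suc (suc m)) = Fin0↔ (¬arndtComp-<3 (s≤s (s≤s z≤n)))
  arndtCount-↔ (suc (suc n)) (suc (suc m)) =
    ↔-trans (Fin+↔⊎ (arndtCount-↔ n (suc (suc m))) (secondOneCount-↔ (suc (suc n)) m))
            (↔-sym lowerFirstPair-↔)

  secondOneCount-↔ : ∀ n m → Fin (secondOneCount n m) ↔ ArndtCompSecondOne n m
  secondOneCount-↔ zero                m =
    Fin0↔ (¬arndtComp-<3 (s≤s z≤n) ∘ forgetSecondOne)
  secondOneCount-↔ (suc zero)          m =
    Fin0↔ (¬arndtComp-<3 (s≤s (s≤s z≤n)) ∘ forgetSecondOne)
  secondOneCount-↔ (suc (suc zero))    m =
    Fin0↔ (¬arndtComp-<3 (s≤s (s≤s (s≤s z≤n))) ∘ forgetSecondOne)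
  secondOneCount-↔ (suc (suc (suc n))) m =
    ↔-trans (Fin+↔⊎ (arndtCount-↔ n m) (secondOneCount-↔ (suc (suc n)) m))
            (↔-sym lowerFirstPart-↔)

↔⇒≡arndtCount : ∀ {a n m} → Fin a ↔ ArndtComp n m → a ≡ arndtCount n m
↔⇒≡arndtCount {n = n} {m} f = ↔⇒≡ (↔-trans f (↔-sym (arndtCount-↔ n m)))

arndtCount-vanishes : ∀ {n m} → n < arndtMinSum m → arndtCount n m ≡ 0
arndtCount-vanishes n<min = sym (↔⇒≡arndtCount (Fin0↔ (¬arndtComp n<min)))

secondOneCount-vanishes : ∀ {n m} → n < arndtMinSum (2 ℕ.+ m) → secondOneCount n m ≡ 0
secondOneCount-vanishes {n} {m} n<min =
  ↔⇒≡ (↔-trans (secondOneCount-↔ n m) (↔-sym (Fin0↔ (¬arndtComp n<min ∘ forgetSecondOne))))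

arndtCount-recurrence : ∀ n m → 3 ≤ n → 2 ≤ m →
  + arndtCount n m ≡
    ((+ arndtCount (n ∸ 1) m + + arndtCount (n ∸ 2) m) - + arndtCount (n ∸ 3) m)
    + + arndtCount (n ∸ 3) (m ∸ 2)
arndtCount-recurrence (suc (suc (suc k))) (suc (suc m)) (s≤s (s≤s (s≤s _))) (s≤s (s≤s _)) =
  ring (+ arndtCount (suc k) (2 ℕ.+ m)) (+ arndtCount k m)
       (+ secondOneCount (2 ℕ.+ k) m) (+ arndtCount k (2 ℕ.+ m))
  where
  ring : ∀ a b c d → a + (b + c) ≡ (((d + c) + a) - d) + b
  ring = ℤ-Ring.solve-∀

-- Read as power series in q, partialSums, altSums and parityPartialSums divide by
-- 1 - q, 1 + q and 1 - q², δ₀ is 1, and _⊛_ is the product.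
δ₀ : ℕ → ℤ
δ₀ zero    = + 1
δ₀ (suc _) = + 0

partialSums : (ℕ → ℤ) → ℕ → ℤ
partialSums w zero    = w 0
partialSums w (suc N) = partialSums w N + w (suc N)

altSums : (ℕ → ℤ) → ℕ → ℤ
altSums w zero    = w 0
altSums w (suc N) = w (suc N) - altSums w N

parityPartialSums : (ℕ → ℤ) → ℕ → ℤ
parityPartialSums w zero          = w 0
parityPartialSums w (suc zero)    = w 1
parityPartialSums w (suc (suc N)) = parityPartialSums w N + w (suc (suc N))

-- (u ⊛ v) (suc N) unfolds definitionally to u 0 * v (suc N) + ((u ∘ suc) ⊛ v) N.
infixl 7 _⊛_
_⊛_ : (ℕ → ℤ) → (ℕ → ℤ) → ℕ → ℤ
(u ⊛ v) N = sumℤ (applyUpTo (λ l → u l * v (N ∸ l)) (suc N))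

partialSums-cong : ∀ {u v} → u ≗ v → partialSums u ≗ partialSums v
partialSums-cong u≗v zero    = u≗v 0
partialSums-cong u≗v (suc N) = cong₂ _+_ (partialSums-cong u≗v N) (u≗v (suc N))

parityPartialSums-cong : ∀ {u v} → u ≗ v → parityPartialSums u ≗ parityPartialSums v
parityPartialSums-cong u≗v zero          = u≗v 0
parityPartialSums-cong u≗v (suc zero)    = u≗v 1
parityPartialSums-cong u≗v (suc (suc N)) =
  cong₂ _+_ (parityPartialSums-cong u≗v N) (u≗v (suc (suc N)))

partialSums∘altSums : ∀ w → partialSums (altSums w) ≗ parityPartialSums w
partialSums∘altSums w zero          = refl
partialSums∘altSums w (suc zero)    = ring (w 0) (w 1)
  where
  ring : ∀ a b → a + (b - a) ≡ b
  ring = ℤ-Ring.solve-∀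
partialSums∘altSums w (suc (suc N)) =
  trans (ring (partialSums (altSums w) N) (altSums w (suc N)) (w (suc (suc N))))
        (cong (_+ w (suc (suc N))) (partialSums∘altSums w N))
  where
  ring : ∀ s a b → (s + a) + (b - a) ≡ s + b
  ring = ℤ-Ring.solve-∀

⊛-cong : ∀ {u u′ v v′} → u ≗ u′ → v ≗ v′ → u ⊛ v ≗ u′ ⊛ v′
⊛-cong u≗u′ v≗v′ zero    = cong (_+ + 0) (cong₂ _*_ (u≗u′ 0) (v≗v′ 0))
⊛-cong u≗u′ v≗v′ (suc N) =
  cong₂ _+_ (cong₂ _*_ (u≗u′ 0) (v≗v′ (suc N))) (⊛-cong (u≗u′ ∘ suc) v≗v′ N)

⊛-congʳ : ∀ u {v v′} → v ≗ v′ → u ⊛ v ≗ u ⊛ v′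
⊛-congʳ u = ⊛-cong {u = u} (λ _ → refl)

⊛-identityʳ : ∀ u → u ⊛ δ₀ ≗ u
⊛-identityʳ u zero    = trans (ℤ.+-identityʳ _) (ℤ.*-identityʳ (u 0))
⊛-identityʳ u (suc N) = begin
  u 0 * + 0 + ((u ∘ suc) ⊛ δ₀) N ≡⟨ cong (_+ ((u ∘ suc) ⊛ δ₀) N) (ℤ.*-zeroʳ (u 0)) ⟩
  + 0 + ((u ∘ suc) ⊛ δ₀) N       ≡⟨ ℤ.+-identityˡ _ ⟩
  ((u ∘ suc) ⊛ δ₀) N             ≡⟨ ⊛-identityʳ (u ∘ suc) N ⟩
  u (suc N)                      ∎
  where open ≡-Reasoning

⊛-distribʳ-+ : ∀ u w v N → ((λ l → u l + w l) ⊛ v) N ≡ (u ⊛ v) N + (w ⊛ v) N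
⊛-distribʳ-+ u w v zero    = ring (u 0) (w 0) (v 0)
  where
  ring : ∀ a b c → (a + b) * c + + 0 ≡ (a * c + + 0) + (b * c + + 0)
  ring = ℤ-Ring.solve-∀
⊛-distribʳ-+ u w v (suc N) =
  trans (cong (λ t → (u 0 + w 0) * v (suc N) + t) (⊛-distribʳ-+ (u ∘ suc) (w ∘ suc) v N))
        (ring (u 0) (w 0) (v (suc N)) (((u ∘ suc) ⊛ v) N) (((w ∘ suc) ⊛ v) N))
  where
  ring : ∀ a b c s t → (a + b) * c + (s + t) ≡ (a * c + s) + (b * c + t)
  ring = ℤ-Ring.solve-∀

⊛-partialSumsˡ : ∀ u v → partialSums u ⊛ v ≗ partialSums (u ⊛ v)
⊛-partialSumsˡ u v zero    = refl
⊛-partialSumsˡ u v (suc N) = begin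
  u 0 * v (suc N) + ((λ l → partialSums u l + u (suc l)) ⊛ v) N
    ≡⟨ cong (λ t → u 0 * v (suc N) + t) (⊛-distribʳ-+ (partialSums u) (u ∘ suc) v N) ⟩
  u 0 * v (suc N) + ((partialSums u ⊛ v) N + ((u ∘ suc) ⊛ v) N)
    ≡⟨ ring (u 0 * v (suc N)) ((partialSums u ⊛ v) N) (((u ∘ suc) ⊛ v) N) ⟩
  (partialSums u ⊛ v) N + (u ⊛ v) (suc N)
    ≡⟨ cong (_+ (u ⊛ v) (suc N)) (⊛-partialSumsˡ u v N) ⟩
  partialSums (u ⊛ v) (suc N) ∎
  where
  open ≡-Reasoning
  ring : ∀ a b c → a + (b + c) ≡ b + (a + c)
  ring = ℤ-Ring.solve-∀

⊛-altSumsʳ-+ : ∀ u v N →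
               (u ⊛ altSums v) (suc N) + (u ⊛ altSums v) N ≡ (u ⊛ v) (suc N)
⊛-altSumsʳ-+ u v zero    = ring (u 0) (u 1) (v 0) (v 1)
  where
  ring : ∀ u₀ u₁ v₀ v₁ →
         (u₀ * (v₁ - v₀) + (u₁ * v₀ + + 0)) + (u₀ * v₀ + + 0) ≡ u₀ * v₁ + (u₁ * v₀ + + 0)
  ring = ℤ-Ring.solve-∀
⊛-altSumsʳ-+ u v (suc N) =
  trans (ring (u 0) (v (suc (suc N))) (altSums v (suc N))
              (((u ∘ suc) ⊛ altSums v) (suc N)) (((u ∘ suc) ⊛ altSums v) N))
        (cong (λ t → u 0 * v (suc (suc N)) + t) (⊛-altSumsʳ-+ (u ∘ suc) v N))
  where
  ring : ∀ a b c s t → (a * (b - c) + s) + (a * c + t) ≡ a * b + (s + t)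
  ring = ℤ-Ring.solve-∀

⊛-altSumsʳ : ∀ u v → u ⊛ altSums v ≗ altSums (u ⊛ v)
⊛-altSumsʳ u v zero    = refl
⊛-altSumsʳ u v (suc N) = begin
  (u ⊛ altSums v) (suc N)
    ≡⟨ ring ((u ⊛ altSums v) (suc N)) ((u ⊛ altSums v) N) ⟩
  ((u ⊛ altSums v) (suc N) + (u ⊛ altSums v) N) - (u ⊛ altSums v) N
    ≡⟨ cong₂ _-_ (⊛-altSumsʳ-+ u v N) (⊛-altSumsʳ u v N) ⟩
  (u ⊛ v) (suc N) - altSums (u ⊛ v) N ∎
  where
  open ≡-Reasoning
  ring : ∀ a b → a ≡ (a + b) - b
  ring = ℤ-Ring.solve-∀

multichoose : ℕ → ℕ → ℕ
multichoose k       zero    = 1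
multichoose zero    (suc j) = 0
multichoose (suc k) (suc j) = multichoose (suc k) j ℕ.+ multichoose k (suc j)

risingFactorial : ℕ → ℕ → ℕ
risingFactorial k zero    = 1
risingFactorial k (suc j) = (k ℕ.+ j) ℕ.* risingFactorial k j

multichoose[k,1]≡k : ∀ k → multichoose k 1 ≡ k
multichoose[k,1]≡k zero    = refl
multichoose[k,1]≡k (suc k) = cong suc (multichoose[k,1]≡k k)

multichoose[1,j]≡1 : ∀ j → multichoose 1 j ≡ 1
multichoose[1,j]≡1 zero    = refl
multichoose[1,j]≡1 (suc j) = trans (ℕ.+-identityʳ _) (multichoose[1,j]≡1 j)

multichoose-absorb : ∀ k j →
                     suc j ℕ.* multichoose k (suc j) ≡ (k ℕ.+ j) ℕ.* multichoose k j
multichoose-absorb zero    zero    = refl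
multichoose-absorb zero    (suc j) = trans (ℕ.*-zeroʳ (2 ℕ.+ j)) (sym (ℕ.*-zeroʳ (suc j)))
multichoose-absorb (suc k) zero    rewrite multichoose[k,1]≡k k = ring k
  where
  ring : ∀ k → 1 ℕ.* (1 ℕ.+ k) ≡ (suc k ℕ.+ 0) ℕ.* 1
  ring = ℕ-Ring.solve-∀
multichoose-absorb (suc k) (suc j) = begin
  (2 ℕ.+ j) ℕ.* ((a ℕ.+ b) ℕ.+ c)                           ≡⟨ expand j a b c ⟩
  (a ℕ.+ b) ℕ.+ suc j ℕ.* (a ℕ.+ b) ℕ.+ (2 ℕ.+ j) ℕ.* c
    ≡⟨ cong₂ (λ x y → (a ℕ.+ b) ℕ.+ x ℕ.+ y)
             (multichoose-absorb (suc k) j) (multichoose-absorb k (suc j)) ⟩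
  (a ℕ.+ b) ℕ.+ (suc k ℕ.+ j) ℕ.* a ℕ.+ (k ℕ.+ suc j) ℕ.* b ≡⟨ collect j k a b ⟩
  (suc k ℕ.+ suc j) ℕ.* (a ℕ.+ b)                           ∎
  where
  open ≡-Reasoning
  a = multichoose (suc k) j
  b = multichoose k (suc j)
  c = multichoose k (2 ℕ.+ j)
  expand : ∀ j a b c → (2 ℕ.+ j) ℕ.* ((a ℕ.+ b) ℕ.+ c) ≡
                       (a ℕ.+ b) ℕ.+ suc j ℕ.* (a ℕ.+ b) ℕ.+ (2 ℕ.+ j) ℕ.* c
  expand = ℕ-Ring.solve-∀
  collect : ∀ j k a b → (a ℕ.+ b) ℕ.+ (suc k ℕ.+ j) ℕ.* a ℕ.+ (k ℕ.+ suc j) ℕ.* b ≡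
                        (suc k ℕ.+ suc j) ℕ.* (a ℕ.+ b)
  collect = ℕ-Ring.solve-∀

multichoose*!≡risingFactorial : ∀ k j → multichoose k j ℕ.* j ! ≡ risingFactorial k j
multichoose*!≡risingFactorial k zero    = refl
multichoose*!≡risingFactorial k (suc j) = begin
  M (suc j) ℕ.* (suc j ℕ.* j !) ≡⟨ ℕ.*-assoc (M (suc j)) (suc j) (j !) ⟨
  M (suc j) ℕ.* suc j ℕ.* j !   ≡⟨ cong (ℕ._* j !) (trans (ℕ.*-comm (M (suc j)) (suc j))
                                                         (multichoose-absorb k j)) ⟩
  (k ℕ.+ j) ℕ.* M j ℕ.* j !     ≡⟨ ℕ.*-assoc (k ℕ.+ j) (M j) (j !) ⟩
  (k ℕ.+ j) ℕ.* (M j ℕ.* j !)   ≡⟨ cong ((k ℕ.+ j) ℕ.*_) (multichoose*!≡risingFactorial k j) ⟩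
  (k ℕ.+ j) ℕ.* risingFactorial k j ∎
  where
  open ≡-Reasoning
  M = multichoose k

falling≡risingFactorial : ∀ k j → falling ((+ k + + j) - + 1) j ≡ + risingFactorial k j
falling≡risingFactorial k zero    = refl
falling≡risingFactorial k (suc j) rewrite ℕ.+-suc k j =
  trans (cong (+ (k ℕ.+ j) *_) (falling≡risingFactorial k j))
        (sym (ℤ.pos-* (k ℕ.+ j) (risingFactorial k j)))

binomℤ≡multichoose : ∀ k j → binomℤ ((+ k + + j) - + 1) j ≡ + multichoose k j
binomℤ≡multichoose k j
  rewrite falling≡risingFactorial k j | sym (multichoose*!≡risingFactorial k j) =
  cong +_ (m*n/n≡m (multichoose k j) (j !) {{j ℕ.!≢0}})

multichooseℤ : ℕ → ℕ → ℤ
multichooseℤ k j = + multichoose k j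

signedMultichoose : ℕ → ℕ → ℤ
signedMultichoose h j = + multichoose h j * signℤ j

multichooseℤ-0 : multichooseℤ 0 ≗ δ₀
multichooseℤ-0 zero    = refl
multichooseℤ-0 (suc j) = refl

signedMultichoose-0 : signedMultichoose 0 ≗ δ₀
signedMultichoose-0 zero    = refl
signedMultichoose-0 (suc j) = ℤ.*-zeroˡ (signℤ (suc j))

multichooseℤ-suc : ∀ k → multichooseℤ (suc k) ≗ partialSums (multichooseℤ k)
multichooseℤ-suc k zero    = refl
multichooseℤ-suc k (suc j) = cong (_+ multichooseℤ k (suc j)) (multichooseℤ-suc k j)

signedMultichoose-suc : ∀ h → signedMultichoose (suc h) ≗ altSums (signedMultichoose h)
signedMultichoose-suc h zero    = refl
signedMultichoose-suc h (suc j) =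
  trans (ring (multichooseℤ (suc h) j) (multichooseℤ h (suc j)) (signℤ j))
        (cong (λ t → signedMultichoose h (suc j) - t) (signedMultichoose-suc h j))
  where
  ring : ∀ a b s → (a + b) * (- s) ≡ b * (- s) - a * s
  ring = ℤ-Ring.solve-∀

arndtSeries : ℕ → ℕ → ℤ
arndtSeries m = multichooseℤ m ⊛ signedMultichoose ⌊ m /2⌋

arndtSeries-2+ : ∀ m →
                 arndtSeries (2 ℕ.+ m) ≗ parityPartialSums (partialSums (arndtSeries m))
arndtSeries-2+ m N = begin
  (multichooseℤ (2 ℕ.+ m) ⊛ signedMultichoose (suc h)) N
    ≡⟨ ⊛-cong (λ j → trans (multichooseℤ-suc (suc m) j)
                           (partialSums-cong (multichooseℤ-suc m) j))
              (signedMultichoose-suc h) N ⟩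
  (partialSums (partialSums u) ⊛ altSums v) N
    ≡⟨ ⊛-partialSumsˡ (partialSums u) (altSums v) N ⟩
  partialSums (partialSums u ⊛ altSums v) N
    ≡⟨ partialSums-cong (⊛-altSumsʳ (partialSums u) v) N ⟩
  partialSums (altSums (partialSums u ⊛ v)) N
    ≡⟨ partialSums∘altSums (partialSums u ⊛ v) N ⟩
  parityPartialSums (partialSums u ⊛ v) N
    ≡⟨ parityPartialSums-cong (⊛-partialSumsˡ u v) N ⟩
  parityPartialSums (partialSums (u ⊛ v)) N ∎
  where
  open ≡-Reasoning
  h = ⌊ m /2⌋
  u = multichooseℤ m
  v = signedMultichoose h

countSeries : ℕ → ℕ → ℤ
countSeries m N = + arndtCount (N ℕ.+ arndtMinSum m) m

secondOneSeries : ℕ → ℕ → ℤ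
secondOneSeries m N = + secondOneCount (3 ℕ.+ (N ℕ.+ arndtMinSum m)) m

k+arndtMinSum<arndtMinSum[2+m] : ∀ {k} m → k ≤ 2 →
                                 k ℕ.+ arndtMinSum m < arndtMinSum (2 ℕ.+ m)
k+arndtMinSum<arndtMinSum[2+m] m k≤2 =
  ℕ.≤-trans (s≤s (ℕ.+-monoˡ-≤ (arndtMinSum m) k≤2)) (ℕ.≤-reflexive (sym (arndtMinSum-2+ m)))

secondOneSeries-partialSums : ∀ m → secondOneSeries m ≗ partialSums (countSeries m)
secondOneSeries-partialSums m zero    =
  trans (cong (λ t → + (arndtCount (arndtMinSum m) m ℕ.+ t))
              (secondOneCount-vanishes (k+arndtMinSum<arndtMinSum[2+m] m (s≤s (s≤s z≤n)))))
        (cong +_ (ℕ.+-identityʳ _))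
secondOneSeries-partialSums m (suc N) =
  trans (ℤ.+-comm (countSeries m (suc N)) (secondOneSeries m N))
        (cong (_+ countSeries m (suc N)) (secondOneSeries-partialSums m N))

countSeries-2+ : ∀ m → countSeries (2 ℕ.+ m) ≗ parityPartialSums (secondOneSeries m)
countSeries-2+ m N = trans (cong (λ n → + arndtCount n (2 ℕ.+ m)) (shift N)) (shifted N)
  where
  shift : ∀ N → N ℕ.+ arndtMinSum (2 ℕ.+ m) ≡ 3 ℕ.+ (N ℕ.+ arndtMinSum m)
  shift N = trans (cong (N ℕ.+_) (arndtMinSum-2+ m)) (ring N (arndtMinSum m))
    where
    ring : ∀ N k → N ℕ.+ (3 ℕ.+ k) ≡ 3 ℕ.+ (N ℕ.+ k)
    ring = ℕ-Ring.solve-∀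

  vanishes : ∀ {k} → k ≤ 2 → arndtCount (k ℕ.+ arndtMinSum m) (2 ℕ.+ m) ≡ 0
  vanishes k≤2 = arndtCount-vanishes (k+arndtMinSum<arndtMinSum[2+m] m k≤2)

  shifted : ∀ N → + arndtCount (3 ℕ.+ (N ℕ.+ arndtMinSum m)) (2 ℕ.+ m) ≡
                  parityPartialSums (secondOneSeries m) N
  shifted zero          =
    cong (λ t → + (t ℕ.+ secondOneCount (3 ℕ.+ arndtMinSum m) m)) (vanishes (s≤s z≤n))
  shifted (suc zero)    =
    cong (λ t → + (t ℕ.+ secondOneCount (4 ℕ.+ arndtMinSum m) m)) (vanishes ℕ.≤-refl)
  shifted (suc (suc N)) = cong (_+ secondOneSeries m (2 ℕ.+ N)) (shifted N)

countSeries≗arndtSeries : ∀ m → countSeries m ≗ arndtSeries m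
countSeries≗arndtSeries zero N = begin
  countSeries 0 N         ≡⟨ countSeries-0 N ⟩
  δ₀ N                    ≡⟨ multichooseℤ-0 N ⟨
  multichooseℤ 0 N        ≡⟨ ⊛-identityʳ (multichooseℤ 0) N ⟨
  (multichooseℤ 0 ⊛ δ₀) N ≡⟨ ⊛-congʳ (multichooseℤ 0) signedMultichoose-0 N ⟨
  arndtSeries 0 N         ∎
  where
  open ≡-Reasoning
  countSeries-0 : countSeries 0 ≗ δ₀
  countSeries-0 zero    = refl
  countSeries-0 (suc N) = refl
countSeries≗arndtSeries (suc zero) N = begin
  countSeries 1 N         ≡⟨ countSeries-1 N ⟩
  + 1                     ≡⟨ cong +_ (multichoose[1,j]≡1 N) ⟨
  multichooseℤ 1 N        ≡⟨ ⊛-identityʳ (multichooseℤ 1) N ⟨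
  (multichooseℤ 1 ⊛ δ₀) N ≡⟨ ⊛-congʳ (multichooseℤ 1) signedMultichoose-0 N ⟨
  arndtSeries 1 N         ∎
  where
  open ≡-Reasoning
  countSeries-1 : ∀ N → countSeries 1 N ≡ + 1
  countSeries-1 zero    = refl
  countSeries-1 (suc N) = refl
countSeries≗arndtSeries (suc (suc m)) N = begin
  countSeries (2 ℕ.+ m) N                           ≡⟨ countSeries-2+ m N ⟩
  parityPartialSums (secondOneSeries m) N           ≡⟨ parityPartialSums-cong IH N ⟩
  parityPartialSums (partialSums (arndtSeries m)) N ≡⟨ arndtSeries-2+ m N ⟨
  arndtSeries (2 ℕ.+ m) N                           ∎
  where
  open ≡-Reasoning
  IH : secondOneSeries m ≗ partialSums (arndtSeries m)
  IH k = trans (secondOneSeries-partialSums m k) (partialSums-cong (countSeries≗arndtSeries m) k)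

m/2≡⌊m/2⌋ : ∀ m → m / 2 ≡ ⌊ m /2⌋
m/2≡⌊m/2⌋ = div-helper≡ 0
  where
  div-helper≡ : ∀ k n → div-helper k 1 n 1 ≡ k ℕ.+ ⌊ n /2⌋
  div-helper≡ k zero          = sym (ℕ.+-identityʳ k)
  div-helper≡ k (suc zero)    = sym (ℕ.+-identityʳ k)
  div-helper≡ k (suc (suc n)) = trans (div-helper≡ (suc k) n) (sym (ℕ.+-suc k ⌊ n /2⌋))

sumℤ-applyUpTo-cong : ∀ n {f g : ℕ → ℤ} → (∀ i → i < n → f i ≡ g i) →
                      sumℤ (applyUpTo f n) ≡ sumℤ (applyUpTo g n)
sumℤ-applyUpTo-cong zero    f≡g = refl
sumℤ-applyUpTo-cong (suc n) f≡g =
  cong₂ _+_ (f≡g 0 (s≤s z≤n)) (sumℤ-applyUpTo-cong n (λ i i<n → f≡g (suc i) (s≤s i<n)))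

arndtCount≡arndtFormula : ∀ n m → + arndtCount n m ≡ arndtFormula n m
arndtCount≡arndtFormula n m with (m ℕ.+ m / 2) ≤? n
... | no  n≱ =
  cong +_ (arndtCount-vanishes (subst (λ h → n < m ℕ.+ h) (m/2≡⌊m/2⌋ m) (ℕ.≰⇒> n≱)))
... | yes ≤n = begin
  + arndtCount n m               ≡⟨ cong (λ k → + arndtCount k m) n≡N+min ⟩
  countSeries m N                ≡⟨ countSeries≗arndtSeries m N ⟩
  arndtSeries m N                ≡⟨ sumℤ-applyUpTo-cong (suc N) term≡ ⟩
  sumℤ (applyUpTo term (suc N))  ≡⟨ cong sumℤ (map-upTo term (suc N)) ⟨
  sumℤ (map term (upTo (suc N))) ∎
  where
  open ≡-Reasoning
  N = n ∸ (m ℕ.+ m / 2)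
  h = ⌊ m /2⌋

  term : ℕ → ℤ
  term ℓ = binomℤ ((+ m + + ℓ) - + 1) ℓ * binomℤ (((+ n - + m) - + ℓ) - + 1) (N ∸ ℓ)
           * signℤ (N ∸ ℓ)

  n≡N+min : n ≡ N ℕ.+ arndtMinSum m
  n≡N+min = sym (trans (cong (λ t → N ℕ.+ (m ℕ.+ t)) (sym (m/2≡⌊m/2⌋ m))) (ℕ.m∸n+n≡m ≤n))

  top≡ : ∀ {ℓ} → ℓ ≤ N → (+ n - + m) - + ℓ ≡ + h + + (N ∸ ℓ)
  top≡ {ℓ} ℓ≤N = trans (cong (λ t → (+ t - + m) - + ℓ) n≡)
                       (ring (+ (N ∸ ℓ)) (+ ℓ) (+ m) (+ h))
    where
    n≡ : n ≡ ((N ∸ ℓ) ℕ.+ ℓ) ℕ.+ arndtMinSum m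
    n≡ = trans n≡N+min (cong (ℕ._+ arndtMinSum m) (sym (ℕ.m∸n+n≡m ℓ≤N)))
    ring : ∀ a b c d → (((a + b) + (c + d)) - c) - b ≡ d + a
    ring = ℤ-Ring.solve-∀

  term≡ : ∀ ℓ → ℓ < suc N → multichooseℤ m ℓ * signedMultichoose h (N ∸ ℓ) ≡ term ℓ
  term≡ ℓ (s≤s ℓ≤N) = begin
    a * (b * s) ≡⟨ ℤ.*-assoc a b s ⟨
    a * b * s   ≡⟨ cong₂ (λ x y → x * y * s) (binomℤ≡multichoose m ℓ) bottom≡ ⟨
    term ℓ      ∎
    where
    a = + multichoose m ℓ
    b = + multichoose h (N ∸ ℓ)
    s = signℤ (N ∸ ℓ)
    bottom≡ : binomℤ (((+ n - + m) - + ℓ) - + 1) (N ∸ ℓ) ≡ b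
    bottom≡ = trans (cong (λ t → binomℤ (t - + 1) (N ∸ ℓ)) (top≡ ℓ≤N))
                    (binomℤ≡multichoose h (N ∸ ℓ))

theorem2p2 : ((n m : ℕ) → Σ ℕ (λ k → (Fin k ↔ ArndtComp n m) × (+ k ≡ arndtFormula n m)))
    × ((n m : ℕ) → 3 ≤ n → 2 ≤ m → (a₀ a₁ a₂ a₃ a₄ : ℕ)
        → (Fin a₀ ↔ ArndtComp n m) → (Fin a₁ ↔ ArndtComp (n ∸ 1) m)
        → (Fin a₂ ↔ ArndtComp (n ∸ 2) m) → (Fin a₃ ↔ ArndtComp (n ∸ 3) m)
        → (Fin a₄ ↔ ArndtComp (n ∸ 3) (m ∸ 2))
        → + a₀ ≡ ((+ a₁ + + a₂) - + a₃) + + a₄)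
theorem2p2 =
    (λ n m → arndtCount n m , arndtCount-↔ n m , arndtCount≡arndtFormula n m)
  , λ n m 3≤n 2≤m _ _ _ _ _ f₀ f₁ f₂ f₃ f₄ →
      trans (count f₀) (trans (arndtCount-recurrence n m 3≤n 2≤m)
        (sym (cong₂ _+_ (cong₂ _-_ (cong₂ _+_ (count f₁) (count f₂)) (count f₃)) (count f₄))))
  where
  count : ∀ {a n m} → Fin a ↔ ArndtComp n m → + a ≡ + arndtCount n m
  count f = cong +_ (↔⇒≡arndtCount f)
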